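{- Let $u\in[2]^n$ be a word of length $n$ over $\{1,2\}$ with $1\le m_1(u)\le m_2(u)$. Then $c_1(u^k)=c_1(u)$ for all $k\ge1$.
   Context: $u^k$ denotes $u$ concatenated with itself $k$ times. $P(w)$ is the insertion tableau of $w$ under the Robinson–Schensted–Knuth (row-insertion) correspondence. $m_a(u)$ is the number of occurrences of the letter $a$ in $u$. For a positive integer $a$, $c_a(w)$ is the number of columns of $P(w)$ of length exactly one whose sole entry is $a$. -}

module Defs where

open import Data.Nat using (ℕ; zero; suc; _≤ᵇ_; _<ᵇ_; _≟_)
open import Data.Bool using (Bool; true; false; if_then_else_)
open import Data.List using (List; []; _∷_; _++_; length; drop; foldl; concat; replicate; filterᵇ)
open import Data.Product using (_×_; _,_)
open import Data.Maybe using (Maybe; just; nothing)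
open import Relation.Nullary.Decidable using (⌊_⌋)

Word : Set
Word = List ℕ

-- A (semistandard) tableau in English notation: list of rows, top row first,
-- each row weakly increasing left to right.
Tableau : Set
Tableau = List (List ℕ)

rowInsert : ℕ → List ℕ → List ℕ × Maybe ℕ
rowInsert x [] = (x ∷ [] , nothing)
rowInsert x (y ∷ ys) with x <ᵇ y
... | true  = (x ∷ ys , just y)
... | false with rowInsert x ys
...   | (ys' , b) = (y ∷ ys' , b)

insertT : ℕ → Tableau → Tableau
insertT x [] = (x ∷ []) ∷ []
insertT x (r ∷ rs) with rowInsert x r
... | (r' , nothing) = r' ∷ rs
... | (r' , just y)  = r' ∷ insertT y rs

P : Word → Tableau
P w = foldl (λ t x → insertT x t) [] w

m : ℕ → Word → ℕ
m a u = length (filterᵇ (λ x → ⌊ x ≟ a ⌋) u)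

_^ʷ_ : Word → ℕ → Word
u ^ʷ k = concat (replicate k u)

-- Columns of a tableau of length exactly one are exactly the columns with index
-- j such that length(row 2) ≤ j < length(row 1); their sole entry is row1[j].
-- So c_a counts entries equal to a in row 1 beyond the length of row 2.
row : ℕ → Tableau → List ℕ
row zero [] = []
row zero (r ∷ _) = r
row (suc i) [] = []
row (suc i) (_ ∷ rs) = row i rs

c : ℕ → Word → ℕ
c a w = m a (drop (length (row 1 (P w))) (row 0 (P w)))

{-# OPTIONS --safe #-}
-- Insertion of 1s and 2s keeps P(w) of the form  row 1 = 1^(d+e) 2^b,  row 2 = 2^d :
-- a 2 is appended to row 1, and a 1 either bumps a 2 of row 1 down to row 2 or, when
-- b = 0, lengthens the 1s.  Reading 2 as an opening and 1 as a closing bracket, e = c₁(w)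
-- is the number of unmatched closing brackets of w and b the number of unmatched opening
-- ones.  When m₁(u) ≤ m₂(u), a copy of u leaves at least as many unmatched 2s as it has
-- unmatched 1s, so in u^k every 1 after the first copy of u is matched.
module Submission where

open import Defs
open import Data.Nat using (ℕ; zero; suc; _+_; _∸_; _≤_)
open import Data.Nat.Properties
open import Algebra.Properties.CommutativeSemigroup +-commutativeSemigroup using (x∙yz≈y∙xz)
open import Data.List using (List; []; _∷_; _++_; length; replicate; drop; foldl)
open import Data.List.Properties using (length-replicate)
open import Data.List.Relation.Unary.All using (All; []; _∷_)
open import Data.List.Relation.Unary.All.Properties using (++⁺)
open import Data.Product using (∃-syntax; _,_)
open import Data.Sum using (_⊎_; inj₁; inj₂)
open import Data.Maybe using (just; nothing)
open import Relation.Binary.PropositionalEquality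

Word₁₂ : Word → Set
Word₁₂ = All (λ x → x ≡ 1 ⊎ x ≡ 2)

^ʷ-Word₁₂ : ∀ {u} k → Word₁₂ u → Word₁₂ (u ^ʷ k)
^ʷ-Word₁₂ zero    wu = []
^ʷ-Word₁₂ (suc k) wu = ++⁺ wu (^ʷ-Word₁₂ k wu)

-- Bracket matching starting from b unmatched 2s; every letter other than 1 counts as a 2.

unmatched₁ : ℕ → Word → ℕ
unmatched₁ b       []          = 0
unmatched₁ zero    (1 ∷ w)     = suc (unmatched₁ zero w)
unmatched₁ (suc b) (1 ∷ w)     = unmatched₁ b w
unmatched₁ b       (_ ∷ w)     = unmatched₁ (suc b) w

unmatched₂ : ℕ → Word → ℕ
unmatched₂ b       []          = b
unmatched₂ zero    (1 ∷ w)     = unmatched₂ zero w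
unmatched₂ (suc b) (1 ∷ w)     = unmatched₂ b w
unmatched₂ b       (_ ∷ w)     = unmatched₂ (suc b) w

unmatched₁-++ : ∀ b u v → Word₁₂ u →
  unmatched₁ b (u ++ v) ≡ unmatched₁ b u + unmatched₁ (unmatched₂ b u) v
unmatched₁-++ zero    []      v []                 = refl
unmatched₁-++ (suc b) []      v []                 = refl
unmatched₁-++ zero    (1 ∷ u) v (inj₁ refl ∷ wu) = cong suc (unmatched₁-++ 0 u v wu)
unmatched₁-++ (suc b) (1 ∷ u) v (inj₁ refl ∷ wu) = unmatched₁-++ b u v wu
unmatched₁-++ zero    (2 ∷ u) v (inj₂ refl ∷ wu) = unmatched₁-++ 1 u v wu
unmatched₁-++ (suc b) (2 ∷ u) v (inj₂ refl ∷ wu) = unmatched₁-++ (suc (suc b)) u v wu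

unmatched₁-∸ : ∀ b u → Word₁₂ u → unmatched₁ b u ≡ unmatched₁ 0 u ∸ b
unmatched₁-∸ zero    []      []                 = refl
unmatched₁-∸ (suc b) []      []                 = refl
unmatched₁-∸ zero    (1 ∷ u) (inj₁ refl ∷ wu) = refl
unmatched₁-∸ (suc b) (1 ∷ u) (inj₁ refl ∷ wu) = unmatched₁-∸ b u wu
unmatched₁-∸ zero    (2 ∷ u) (inj₂ refl ∷ wu) = refl
unmatched₁-∸ (suc b) (2 ∷ u) (inj₂ refl ∷ wu) = begin
  unmatched₁ (2 + b) u        ≡⟨ unmatched₁-∸ (2 + b) u wu ⟩
  unmatched₁ 0 u ∸ (1 + suc b) ≡⟨ ∸-+-assoc (unmatched₁ 0 u) 1 (suc b) ⟨
  unmatched₁ 0 u ∸ 1 ∸ suc b  ≡⟨ cong (_∸ suc b) (unmatched₁-∸ 1 u wu) ⟨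
  unmatched₁ 1 u ∸ suc b      ∎
  where open ≡-Reasoning

unmatched-balance : ∀ b u → Word₁₂ u →
  unmatched₂ b u + m 1 u ≡ b + (m 2 u + unmatched₁ b u)
unmatched-balance zero    []      []                 = refl
unmatched-balance (suc b) []      []                 = cong suc (trans (+-identityʳ b) (sym (+-identityʳ b)))
unmatched-balance zero    (1 ∷ u) (inj₁ refl ∷ wu)
  rewrite +-suc (unmatched₂ 0 u) (m 1 u) | unmatched-balance 0 u wu
        | +-suc (m 2 u) (unmatched₁ 0 u) = refl
unmatched-balance (suc b) (1 ∷ u) (inj₁ refl ∷ wu)
  rewrite +-suc (unmatched₂ b u) (m 1 u) | unmatched-balance b u wu = refl
unmatched-balance zero    (2 ∷ u) (inj₂ refl ∷ wu) = unmatched-balance 1 u wu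
unmatched-balance (suc b) (2 ∷ u) (inj₂ refl ∷ wu)
  rewrite unmatched-balance (2 + b) u wu = cong suc (sym (+-suc b _))

unmatched₁≤unmatched₂ : ∀ b u → Word₁₂ u → m 1 u ≤ m 2 u →
  b + unmatched₁ b u ≤ unmatched₂ b u
unmatched₁≤unmatched₂ b u wu m₁≤m₂ = +-cancelˡ-≤ (m 1 u) _ _ (begin
  m 1 u + (b + unmatched₁ b u) ≤⟨ +-monoˡ-≤ _ m₁≤m₂ ⟩
  m 2 u + (b + unmatched₁ b u) ≡⟨ x∙yz≈y∙xz (m 2 u) b _ ⟩
  b + (m 2 u + unmatched₁ b u) ≡⟨ unmatched-balance b u wu ⟨
  unmatched₂ b u + m 1 u       ≡⟨ +-comm (unmatched₂ b u) (m 1 u) ⟩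
  m 1 u + unmatched₂ b u       ∎)
  where open ≤-Reasoning

unmatched₁-^ʷ : ∀ u k b → Word₁₂ u → m 1 u ≤ m 2 u →
  unmatched₁ 0 u ≤ b → unmatched₁ b (u ^ʷ k) ≡ 0
unmatched₁-^ʷ u zero    b wu m₁≤m₂ u≤b = refl
unmatched₁-^ʷ u (suc k) b wu m₁≤m₂ u≤b
  rewrite unmatched₁-++ b u (u ^ʷ k) wu | unmatched₁-∸ b u wu | m≤n⇒m∸n≡0 u≤b
  = unmatched₁-^ʷ u k (unmatched₂ b u) wu m₁≤m₂
      (≤-trans u≤b (≤-trans (m≤m+n b _) (unmatched₁≤unmatched₂ b u wu m₁≤m₂)))

secondRow : ℕ → Tableau
secondRow zero    = []
secondRow (suc d) = replicate (suc d) 2 ∷ []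

-- The first d 1s of the first row lie above the second row; the other e form c₁.
twoRowTableau : ℕ → ℕ → ℕ → Tableau
twoRowTableau e b d = (replicate (d + e) 1 ++ replicate b 2) ∷ secondRow d

rowInsert-2-2s : ∀ b → rowInsert 2 (replicate b 2) ≡ (replicate (suc b) 2 , nothing)
rowInsert-2-2s zero    = refl
rowInsert-2-2s (suc b) rewrite rowInsert-2-2s b = refl

rowInsert-2 : ∀ a b →
  rowInsert 2 (replicate a 1 ++ replicate b 2) ≡ (replicate a 1 ++ replicate (suc b) 2 , nothing)
rowInsert-2 zero    b = rowInsert-2-2s b
rowInsert-2 (suc a) b rewrite rowInsert-2 a b = refl

rowInsert-1-bump : ∀ a b →
  rowInsert 1 (replicate a 1 ++ replicate (suc b) 2) ≡ (replicate (suc a) 1 ++ replicate b 2 , just 2)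
rowInsert-1-bump zero    b = refl
rowInsert-1-bump (suc a) b rewrite rowInsert-1-bump a b = refl

rowInsert-1-append : ∀ a →
  rowInsert 1 (replicate a 1 ++ replicate 0 2) ≡ (replicate (suc a) 1 ++ replicate 0 2 , nothing)
rowInsert-1-append zero    = refl
rowInsert-1-append (suc a) rewrite rowInsert-1-append a = refl

insertT-2 : ∀ e b d → insertT 2 (twoRowTableau e b d) ≡ twoRowTableau e (suc b) d
insertT-2 e b d rewrite rowInsert-2 (d + e) b = refl

insertT-1-matched : ∀ e b d → insertT 1 (twoRowTableau e (suc b) d) ≡ twoRowTableau e b (suc d)
insertT-1-matched e b zero    rewrite rowInsert-1-bump e b = refl
insertT-1-matched e b (suc d) rewrite rowInsert-1-bump (suc d + e) b | rowInsert-2-2s (suc d) = refl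

insertT-1-unmatched : ∀ e d → insertT 1 (twoRowTableau e 0 d) ≡ twoRowTableau (suc e) 0 d
insertT-1-unmatched e d rewrite rowInsert-1-append (d + e) | +-suc d e = refl

insertAll-twoRowTableau : ∀ e b d w → Word₁₂ w →
  ∃[ d′ ] foldl (λ t x → insertT x t) (twoRowTableau e b d) w
            ≡ twoRowTableau (e + unmatched₁ b w) (unmatched₂ b w) d′
insertAll-twoRowTableau e b d [] [] rewrite +-identityʳ e = d , refl
insertAll-twoRowTableau e zero d (1 ∷ w) (inj₁ refl ∷ ww)
  rewrite insertT-1-unmatched e d | +-suc e (unmatched₁ 0 w) = insertAll-twoRowTableau (suc e) 0 d w ww
insertAll-twoRowTableau e (suc b) d (1 ∷ w) (inj₁ refl ∷ ww)
  rewrite insertT-1-matched e b d = insertAll-twoRowTableau e b (suc d) w ww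
insertAll-twoRowTableau e zero d (2 ∷ w) (inj₂ refl ∷ ww)
  rewrite insertT-2 e zero d = insertAll-twoRowTableau e 1 d w ww
insertAll-twoRowTableau e (suc b) d (2 ∷ w) (inj₂ refl ∷ ww)
  rewrite insertT-2 e (suc b) d = insertAll-twoRowTableau e (2 + b) d w ww

length-secondRow : ∀ d → length (row 0 (secondRow d)) ≡ d
length-secondRow zero    = refl
length-secondRow (suc d) = length-replicate (suc d)

drop-replicate-+ : ∀ d e (ys : List ℕ) → drop d (replicate (d + e) 1 ++ ys) ≡ replicate e 1 ++ ys
drop-replicate-+ zero    e ys = refl
drop-replicate-+ (suc d) e ys = drop-replicate-+ d e ys

m₁-1s2s : ∀ e b → m 1 (replicate e 1 ++ replicate b 2) ≡ e
m₁-1s2s zero    zero    = refl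
m₁-1s2s zero    (suc b) = m₁-1s2s zero b
m₁-1s2s (suc e) b       = cong suc (m₁-1s2s e b)

c₁≡unmatched₁ : ∀ w → Word₁₂ w → c 1 w ≡ unmatched₁ 0 w
c₁≡unmatched₁ [] [] = refl
c₁≡unmatched₁ w@(_ ∷ _) ww with insertAll-twoRowTableau 0 0 0 w ww
... | d , P≡ rewrite P≡ | length-secondRow d
                  | drop-replicate-+ d (unmatched₁ 0 w) (replicate (unmatched₂ 0 w) 2)
  = m₁-1s2s (unmatched₁ 0 w) (unmatched₂ 0 w)

lemma2p11 : (n : ℕ) (u : Word) → length u ≡ n → All (λ x → x ≡ 1 ⊎ x ≡ 2) u →
    1 ≤ m 1 u → m 1 u ≤ m 2 u →
    (k : ℕ) → 1 ≤ k → c 1 (u ^ʷ k) ≡ c 1 u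
lemma2p11 _ u _ wu _ m₁≤m₂ (suc k) _ = begin
  c 1 (u ^ʷ suc k)                                    ≡⟨ c₁≡unmatched₁ (u ^ʷ suc k) (^ʷ-Word₁₂ (suc k) wu) ⟩
  unmatched₁ 0 (u ++ u ^ʷ k)                          ≡⟨ unmatched₁-++ 0 u (u ^ʷ k) wu ⟩
  unmatched₁ 0 u + unmatched₁ (unmatched₂ 0 u) (u ^ʷ k) ≡⟨ cong (unmatched₁ 0 u +_) rest-matched ⟩
  unmatched₁ 0 u + 0                                  ≡⟨ +-identityʳ _ ⟩
  unmatched₁ 0 u                                      ≡⟨ c₁≡unmatched₁ u wu ⟨
  c 1 u                                               ∎
  where
  open ≡-Reasoning
  rest-matched : unmatched₁ (unmatched₂ 0 u) (u ^ʷ k) ≡ 0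
  rest-matched = unmatched₁-^ʷ u k (unmatched₂ 0 u) wu m₁≤m₂ (unmatched₁≤unmatched₂ 0 u wu m₁≤m₂)
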